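{- Let $\mathcal{C}$ be the set of Łukasiewicz paths having no flat step $F$ at positive height and in which every up step $U_k$ ($k\geq 1$) is immediately followed by a down step $D$. For every $n\geq 0$, there is a bijection between the set of paths of length $n$ in $\mathcal{C}$ and the set of $U_kD$-equivalence classes of the set $\mathcal{L}_n$ of Łukasiewicz paths of length $n$.
   Context: A Łukasiewicz path of length $n$ is a sequence of $n$ steps from $\{(1,i): i\geq -1\}$ starting at $(0,0)$, ending at $(n,0)$ and never going below the $x$-axis. Write $D=(1,-1)$, $F=(1,0)$, $U_k=(1,k)$ for $k\geq1$. The height of a step is the minimal ordinate of its endpoints. Steps are numbered $1,\dots,n$; an occurrence of the two-step pattern $U_kD$ is at position $i$ if its $U_k$ is the $i$-th step. Two Łukasiewicz paths of the same length are $U_kD$-equivalent if for every $k\geq 1$ the set of occurrence positions of $U_kD$ is the same in both paths. -}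

module Defs where

open import Data.Nat using (ℕ; zero; suc; _+_; _∸_)
open import Data.List using (List; []; _∷_; length; drop)
open import Data.Product using (Σ; ∃; _×_; _,_; proj₁; proj₂)
open import Data.Unit using (⊤)
open import Function using (_on_)
open import Function.Bundles using (_⇔_; mk⇔; Equivalence)
open import Relation.Binary.Bundles using (Setoid)
open import Relation.Binary.Structures using (IsEquivalence)
open import Relation.Binary.PropositionalEquality using (_≡_; refl; sym; trans)
import Relation.Binary.Construct.On as On

-- Steps of a Łukasiewicz path:  D = (1,-1),  F = (1,0),  Up j = U_{j+1} = (1, j+1).
-- (So  U_k  for k ≥ 1 is  Up (k ∸ 1); the constructor Up ranges over all k ≥ 1.)
data Step : Set where
  D  : Step
  F  : Step
  Up : ℕ → Step

-- Walk h s : the step sequence s, started at height h, never goes below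
-- the x-axis and ends at height 0.
data Walk : ℕ → List Step → Set where
  end : Walk 0 []
  dn  : ∀ {h s} → Walk h s → Walk (suc h) (D ∷ s)
  fl  : ∀ {h s} → Walk h s → Walk h (F ∷ s)
  up  : ∀ {h j s} → Walk (h + suc j) s → Walk h (Up j ∷ s)

IsLuk : List Step → Set
IsLuk s = Walk 0 s

-- Starting at height h, no flat step F of s lies at positive height
-- (the height of an F step is the ordinate of its endpoints).
NoFlatPos : ℕ → List Step → Set
NoFlatPos h []          = ⊤
NoFlatPos h (D ∷ s)     = NoFlatPos (h ∸ 1) s
NoFlatPos h (F ∷ s)     = (h ≡ 0) × NoFlatPos h s
NoFlatPos h (Up j ∷ s)  = NoFlatPos (h + suc j) s

-- Every up step is immediately followed by a down step D.
-- Positions are 0-based here (step i of the paper is index i ∸ 1).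
UpFollowedByD : List Step → Set
UpFollowedByD s = ∀ i j t → drop i s ≡ Up j ∷ t → ∃ λ t' → t ≡ D ∷ t'

Occ : ℕ → ℕ → List Step → Set
Occ j i s = ∃ λ t → drop i s ≡ Up j ∷ D ∷ t

UkDEquiv : List Step → List Step → Set
UkDEquiv p q = ∀ j i → Occ j i p ⇔ Occ j i q

Lpath : ℕ → Set
Lpath n = Σ (List Step) λ s → (length s ≡ n) × IsLuk s

Cpath : ℕ → Set
Cpath n = Σ (List Step) λ s → (length s ≡ n) × IsLuk s × NoFlatPos 0 s × UpFollowedByD s

private
  ⇔-refl : ∀ {A : Set} → A ⇔ A
  ⇔-refl = mk⇔ (λ x → x) (λ x → x)
  ⇔-sym : ∀ {A B : Set} → A ⇔ B → B ⇔ A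
  ⇔-sym e = mk⇔ (Equivalence.from e) (Equivalence.to e)
  ⇔-trans : ∀ {A B C : Set} → A ⇔ B → B ⇔ C → A ⇔ C
  ⇔-trans e f = mk⇔ (λ x → Equivalence.to f (Equivalence.to e x))
                    (λ x → Equivalence.from e (Equivalence.from f x))

UkDEquiv-isEquivalence : IsEquivalence UkDEquiv
UkDEquiv-isEquivalence = record
  { refl  = λ j i → ⇔-refl
  ; sym   = λ e j i → ⇔-sym (e j i)
  ; trans = λ e f j i → ⇔-trans (e j i) (f j i)
  }

-- L_n together with U_kD-equivalence; a bijection out of C_n into this setoid
-- is a bijection onto the set of U_kD-equivalence classes of L_n.
LSetoid : ℕ → Setoid _ _
LSetoid n = record
  { Carrier = Lpath n
  ; _≈_ = UkDEquiv on proj₁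
  ; isEquivalence = On.isEquivalence proj₁ UkDEquiv-isEquivalence
  }

CSetoid : ℕ → Setoid _ _
CSetoid n = record
  { Carrier = Cpath n
  ; _≈_ = _≡_ on proj₁
  ; isEquivalence = On.isEquivalence proj₁ (record { refl = refl ; sym = sym ; trans = trans })
  }

-- Split a path into its U_kD blocks and its remaining single steps. The length and
-- the U_kD occurrence sets determine where the blocks sit, so the path obtained by
-- keeping the blocks and replacing every other step by D above the axis and by F on
-- it depends only on the equivalence class. That path lies in C: it never rises
-- above the original path, hence stays nonnegative, and ends at height 0 because
-- the original does. Conversely a path of C is left unchanged, since in C every
-- step outside a block is a D above the axis or an F on it.
module Submission where

open import Defs
open import Data.Nat using (ℕ)
open import Function.Bundles using (Bijection)

open import Data.Nat using (zero; suc; _+_; _∸_; _≤_; z≤n)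
open import Data.Nat.Properties
  using (+-suc; suc-injective; ∸-monoˡ-≤; m∸n≤m; ≤-trans; m≤m+n; +-monoˡ-≤)
open import Data.List using (List; []; _∷_; length)
open import Data.Product using (∃; _,_; proj₁)
open import Data.Empty using (⊥; ⊥-elim)
open import Function.Bundles using (_⇔_; mk⇔; Equivalence)
open import Relation.Binary.PropositionalEquality
  using (_≡_; refl; sym; trans; cong; subst; module ≡-Reasoning)

NotUD : Step → List Step → Set
NotUD x s = ∀ j t → x ∷ s ≡ Up j ∷ D ∷ t → ⊥

data UDView : List Step → Set where
  []    : UDView []
  ud    : ∀ j {s} → UDView s → UDView (Up j ∷ D ∷ s)
  other : ∀ x {s} → NotUD x s → UDView s → UDView (x ∷ s)

udView : ∀ s → UDView s
udView []                = []
udView (Up j ∷ D ∷ s)    = ud j (udView s)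
udView (D ∷ s)           = other D (λ _ _ ()) (udView s)
udView (F ∷ s)           = other F (λ _ _ ()) (udView s)
udView (Up j ∷ [])       = other (Up j) (λ _ _ ()) []
udView (Up j ∷ F ∷ s)    = other (Up j) (λ _ _ ()) (udView (F ∷ s))
udView (Up j ∷ Up k ∷ s) = other (Up j) (λ _ _ ()) (udView (Up k ∷ s))

descend : ℕ → Step
descend zero    = F
descend (suc _) = D

canonical : ∀ {s} → ℕ → UDView s → List Step
canonical h []            = []
canonical h (ud j v)      = Up j ∷ D ∷ canonical (h + j) v
canonical h (other _ _ v) = descend h ∷ canonical (h ∸ 1) v

length-canonical : ∀ h {s} (v : UDView s) → length (canonical h v) ≡ length s
length-canonical h []            = refl
length-canonical h (ud j v)      = cong (λ n → suc (suc n)) (length-canonical (h + j) v)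
length-canonical h (other _ _ v) = cong suc (length-canonical (h ∸ 1) v)

Walk-D⁻¹ : ∀ {h s} → Walk (suc h) (D ∷ s) → Walk h s
Walk-D⁻¹ (dn w) = w

Walk-UD⁻¹ : ∀ {h j s} → Walk h (Up j ∷ D ∷ s) → Walk (h + j) s
Walk-UD⁻¹ {h} {j} {s} (up w) = Walk-D⁻¹ (subst (λ k → Walk k (D ∷ s)) (+-suc h j) w)

Walk-UD : ∀ {h j s} → Walk (h + j) s → Walk h (Up j ∷ D ∷ s)
Walk-UD {h} {j} {s} w = up (subst (λ k → Walk k (D ∷ s)) (sym (+-suc h j)) (dn w))

Walk-descend : ∀ h {s} → Walk (h ∸ 1) s → Walk h (descend h ∷ s)
Walk-descend zero    w = fl w
Walk-descend (suc h) w = dn w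

canonical-Walk : ∀ {hp s} hq (v : UDView s) → Walk hp s → hq ≤ hp → Walk hq (canonical hq v)
canonical-Walk hq []                  end   z≤n = end
canonical-Walk hq (ud j v)            w     le  =
  Walk-UD (canonical-Walk (hq + j) v (Walk-UD⁻¹ w) (+-monoˡ-≤ j le))
canonical-Walk hq (other D _ v)       (dn w) le =
  Walk-descend hq (canonical-Walk (hq ∸ 1) v w (∸-monoˡ-≤ 1 le))
canonical-Walk hq (other F _ v)       (fl w) le =
  Walk-descend hq (canonical-Walk (hq ∸ 1) v w (≤-trans (m∸n≤m hq 1) le))
canonical-Walk {hp} hq (other (Up j) _ v) (up w) le =
  Walk-descend hq (canonical-Walk (hq ∸ 1) v w
    (≤-trans (m∸n≤m hq 1) (≤-trans le (m≤m+n hp (suc j)))))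

canonical-NoFlatPos : ∀ h {s} (v : UDView s) → NoFlatPos h (canonical h v)
canonical-NoFlatPos h       []            = _
canonical-NoFlatPos h       (ud j v)      =
  subst (λ k → NoFlatPos k (canonical (h + j) v))
        (cong (_∸ 1) (sym (+-suc h j))) (canonical-NoFlatPos (h + j) v)
canonical-NoFlatPos zero    (other _ _ v) = refl , canonical-NoFlatPos zero v
canonical-NoFlatPos (suc h) (other _ _ v) = canonical-NoFlatPos h v

canonical-UpFollowedByD : ∀ h {s} (v : UDView s) → UpFollowedByD (canonical h v)
canonical-UpFollowedByD h       (ud j v)      zero          .j _ refl = _ , refl
canonical-UpFollowedByD h       (ud j v)      (suc (suc i)) = canonical-UpFollowedByD (h + j) v i
canonical-UpFollowedByD h       (other _ _ v) (suc i)       = canonical-UpFollowedByD (h ∸ 1) v i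
canonical-UpFollowedByD h       []            zero          _ _ ()
canonical-UpFollowedByD h       []            (suc i)       _ _ ()
canonical-UpFollowedByD h       (ud j v)      (suc zero)    _ _ ()
canonical-UpFollowedByD zero    (other _ _ v) zero          _ _ ()
canonical-UpFollowedByD (suc h) (other _ _ v) zero          _ _ ()

Occ-[] : ∀ j i → Occ j i [] → ⊥
Occ-[] j zero    (_ , ())
Occ-[] j (suc i) (_ , ())

Occ-canonical⁻ : ∀ h {s} (v : UDView s) j i → Occ j i (canonical h v) → Occ j i s
Occ-canonical⁻ h       []            j i             o       = ⊥-elim (Occ-[] j i o)
Occ-canonical⁻ h       (ud k v)      j zero          (_ , refl) = _ , refl
Occ-canonical⁻ h       (ud k v)      j (suc (suc i)) o       = Occ-canonical⁻ (h + k) v j i o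
Occ-canonical⁻ h       (other _ _ v) j (suc i)       o       = Occ-canonical⁻ (h ∸ 1) v j i o
Occ-canonical⁻ h       (ud k v)      j (suc zero)    (_ , ())
Occ-canonical⁻ zero    (other _ _ v) j zero          (_ , ())
Occ-canonical⁻ (suc h) (other _ _ v) j zero          (_ , ())

Occ-canonical⁺ : ∀ h {s} (v : UDView s) j i → Occ j i s → Occ j i (canonical h v)
Occ-canonical⁺ h []              j i             o          = ⊥-elim (Occ-[] j i o)
Occ-canonical⁺ h (ud k v)        j zero          (_ , refl) = _ , refl
Occ-canonical⁺ h (ud k v)        j (suc zero)    (_ , ())
Occ-canonical⁺ h (ud k v)        j (suc (suc i)) o          = Occ-canonical⁺ (h + k) v j i o
Occ-canonical⁺ h (other _ ¬ud v) j zero          (t , e)    = ⊥-elim (¬ud j t e)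
Occ-canonical⁺ h (other _ _ v)   j (suc i)       o          = Occ-canonical⁺ (h ∸ 1) v j i o

canonical-UkDEquiv : ∀ h {s} (v : UDView s) → UkDEquiv (canonical h v) s
canonical-UkDEquiv h v j i = mk⇔ (Occ-canonical⁻ h v j i) (Occ-canonical⁺ h v j i)

canonical-cong : ∀ h {p q} (vp : UDView p) (vq : UDView q) →
                 length p ≡ length q → UkDEquiv p q → canonical h vp ≡ canonical h vq
canonical-cong h []             []             _  _ = refl
canonical-cong h []             (ud _ _)       () _
canonical-cong h []             (other _ _ _)  () _
canonical-cong h (other _ _ _)  []             () _
canonical-cong h (ud j vp)      []             _  e = ⊥-elim (Occ-[] j 0 (Equivalence.to (e j 0) (_ , refl)))
canonical-cong h (ud j vp)      (ud k vq)      l  e with Equivalence.to (e j 0) (_ , refl)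
... | _ , refl = cong (λ r → Up j ∷ D ∷ r)
  (canonical-cong (h + j) vp vq (suc-injective (suc-injective l)) (λ j′ i → e j′ (suc (suc i))))
canonical-cong h (ud j vp)      (other _ ¬ud vq) _ e with Equivalence.to (e j 0) (_ , refl)
... | t , eq = ⊥-elim (¬ud j t eq)
canonical-cong h (other _ ¬ud vp) (ud k vq)    _ e with Equivalence.from (e k 0) (_ , refl)
... | t , eq = ⊥-elim (¬ud k t eq)
canonical-cong h (other _ _ vp) (other _ _ vq) l  e =
  cong (descend h ∷_) (canonical-cong (h ∸ 1) vp vq (suc-injective l) (λ j i → e j (suc i)))

canonical-fixes : ∀ h {s} (v : UDView s) →
                  Walk h s → NoFlatPos h s → UpFollowedByD s → canonical h v ≡ s
canonical-fixes h []              _      _          _ = refl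
canonical-fixes h (ud j {s} v)    w      nf         u =
  cong (λ r → Up j ∷ D ∷ r)
    (canonical-fixes (h + j) v (Walk-UD⁻¹ w)
      (subst (λ k → NoFlatPos k s) (cong (_∸ 1) (+-suc h j)) nf) (λ i → u (suc (suc i))))
canonical-fixes _ (other D _ v)   (dn w) nf         u =
  cong (D ∷_) (canonical-fixes _ v w nf (λ i → u (suc i)))
canonical-fixes _ (other F _ v)   (fl w) (refl , nf) u =
  cong (F ∷_) (canonical-fixes zero v w nf (λ i → u (suc i)))
canonical-fixes h (other (Up j) {s} ¬ud v) _ _      u with u 0 j s refl
... | t , refl = ⊥-elim (¬ud j t refl)

lemma3 : (n : ℕ) → Bijection (CSetoid n) (LSetoid n)
lemma3 n = record
  { to        = forget
  ; cong      = λ { refl j i → mk⇔ (λ o → o) (λ o → o) }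
  ; bijective = (λ {x} {y} → injective {x} {y}) , surjective
  }
  where
    forget : Cpath n → Lpath n
    forget (s , l , w , _ , _) = s , l , w

    injective : ∀ {x y : Cpath n} → UkDEquiv (proj₁ x) (proj₁ y) → proj₁ x ≡ proj₁ y
    injective {s , l , w , nf , u} {s′ , l′ , w′ , nf′ , u′} e = begin
      s                        ≡⟨ sym (canonical-fixes 0 (udView s) w nf u) ⟩
      canonical 0 (udView s)   ≡⟨ canonical-cong 0 (udView s) (udView s′) (trans l (sym l′)) e ⟩
      canonical 0 (udView s′)  ≡⟨ canonical-fixes 0 (udView s′) w′ nf′ u′ ⟩
      s′                       ∎
      where open ≡-Reasoning

    surjective : ∀ (y : Lpath n) → ∃ λ (x : Cpath n) →
                 ∀ {z : Cpath n} → proj₁ z ≡ proj₁ x → UkDEquiv (proj₁ (forget z)) (proj₁ y)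
    surjective (s , l , w) =
      ( canonical 0 v
      , trans (length-canonical 0 v) l
      , canonical-Walk 0 v w z≤n
      , canonical-NoFlatPos 0 v
      , canonical-UpFollowedByD 0 v )
      , λ { refl → canonical-UkDEquiv 0 v }
      where v = udView s
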